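{- Let $X=(T,T')\in\mathcal{T}_n\times\mathcal{T}_n$. There exist nodes $v$ of $T$ and $v'$ of $T'$ with $x'_\ell<x_\ell\le x'_r<x_r$ (where $x_\ell,x_r$, resp. $x'_\ell,x'_r$, are the indices of the leftmost and rightmost leaves of the subtree of $T$ rooted at $v$, resp. of $T'$ rooted at $v'$) if and only if $\phi(X)$ has a flawed pair, i.e. a lower arc with ends $y_\ell<y_r$ and an upper arc with ends $y'_\ell<y'_r$ with $y'_\ell<y_\ell<y'_r<y_r$.
   Context: A binary tree is either a single leaf or a node with an ordered pair (left, right) of binary subtrees; its size is its number of nodes, $\mathcal{T}_n$ is the set of binary trees of size $n$, and in such a tree the $n+1$ leaves are indexed $0,\dots,n$ from left to right. For $T\in\mathcal{T}_n$ label its nodes $v_1,\dots,v_n$ in infix order and let $a_t(T)$ (resp. $b_t(T)$) be the number of nodes in the right (resp. left) subtree of $v_t$. $\phi(T,T')$ is the arc-diagram on the points $0,\tfrac12,\dots,n$ of the horizontal axis having, for each $t\in[n]$, an upper arc (in the upper half-plane) joining $t-\tfrac12$ and $t-1-b_t(T')$, and a lower arc (in the lower half-plane) joining $t-\tfrac12$ and $t+a_t(T)$. -}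

module Defs where

open import Data.Nat using (ℕ; zero; suc; _+_; _*_; _∸_; _≤_; _<_; _⊓_; _⊔_; _≤ᵇ_; _≡ᵇ_)
open import Data.Bool using (if_then_else_)
open import Data.Product using (Σ; _×_; _,_; ∃; ∃-syntax)

data Tree : Set where
  leaf : Tree
  node : Tree → Tree → Tree

size : Tree → ℕ
size leaf = 0
size (node l r) = suc (size l + size r)

data Node : Tree → Set where
  here : ∀ {l r} → Node (node l r)
  inl  : ∀ {l r} → Node l → Node (node l r)
  inr  : ∀ {l r} → Node r → Node (node l r)

-- Index (leaves numbered 0..size T from left to right) of the leftmost,
-- resp. rightmost, leaf of the subtree rooted at a node.
leftLeaf : (T : Tree) → Node T → ℕ
leftLeaf (node l r) here    = 0
leftLeaf (node l r) (inl p) = leftLeaf l p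
leftLeaf (node l r) (inr p) = suc (size l) + leftLeaf r p

rightLeaf : (T : Tree) → Node T → ℕ
rightLeaf (node l r) here    = size (node l r)
rightLeaf (node l r) (inl p) = rightLeaf l p
rightLeaf (node l r) (inr p) = suc (size l) + rightLeaf r p

-- Nodes labelled v_1..v_n in infix order.
-- a t T = number of nodes in the right subtree of v_t,
-- b t T = number of nodes in the left subtree of v_t
-- (meaningful for 1 ≤ t ≤ size T; value 0 otherwise).
a : Tree → ℕ → ℕ
a leaf t = 0
a (node l r) t =
  if t ≤ᵇ size l then a l t
  else if t ≡ᵇ suc (size l) then size r
  else a r (t ∸ suc (size l))

b : Tree → ℕ → ℕ
b leaf t = 0
b (node l r) t =
  if t ≤ᵇ size l then b l t
  else if t ≡ᵇ suc (size l) then size l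
  else b r (t ∸ suc (size l))

-- Points of the arc diagram are 0, 1/2, ..., n; we represent a point x by 2x ∈ ℕ.
-- An arc is given by its two (doubled) endpoints.
Arc : Set
Arc = ℕ × ℕ

lowerArc : Tree → ℕ → Arc
lowerArc T t = (2 * t ∸ 1 , 2 * (t + a T t))

upperArc : Tree → ℕ → Arc
upperArc T' t = (2 * t ∸ 1 , 2 * (t ∸ 1 ∸ b T' t))

leftEnd rightEnd : Arc → ℕ
leftEnd  (x , y) = x ⊓ y
rightEnd (x , y) = x ⊔ y

HasFlawedPair : ℕ → Tree → Tree → Set
HasFlawedPair n T T' =
  ∃[ t ] ∃[ s ] ((1 ≤ t × t ≤ n) × (1 ≤ s × s ≤ n) ×
    (leftEnd (upperArc T' s) < leftEnd (lowerArc T t) ×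
     leftEnd (lowerArc T t) < rightEnd (upperArc T' s) ×
     rightEnd (upperArc T' s) < rightEnd (lowerArc T t)))

-- The lower arc of t spans the leaves [t, t + a_t] of the right subtree of v_t,
-- with its left end moved ½ to the left; the upper arc of s spans the leaves
-- [s-1-b_s, s-1] of the left subtree of v'_s, with its right end moved ½ to the
-- right.  So a flawed pair of arcs is the same as an interleaved pair of such
-- subtrees.  Conversely, a subtree whose leftmost leaf is ℓ > 0 lies inside the
-- right subtree of v_ℓ, and one whose rightmost leaf is ρ < n inside the left
-- subtree of v'_{ρ+1}; replacing an interleaved pair of subtrees by these two
-- larger ones keeps it interleaved.
module Submission where

open import Defs
open import Data.Nat using (ℕ; zero; suc; _+_; _*_; _∸_; _≤_; _<_; _≤ᵇ_; _≡ᵇ_; z≤n; s≤s; z<s)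
open import Data.Nat.Properties
open import Data.Bool using (true; false)
open import Data.Bool.Properties using (T-≡; ¬-not)
open import Data.Product using (_×_; _,_; ∃-syntax)
open import Data.Product.Function.NonDependent.Propositional using (_×-⇔_)
open import Data.Sum using (inj₁; inj₂)
open import Data.Empty using (⊥-elim)
open import Relation.Binary.PropositionalEquality
open import Function.Bundles using (_⇔_; mk⇔; Equivalence)
open import Function.Properties.Equivalence using () renaming (trans to ⇔-trans)

≤ᵇ-true : ∀ {m n} → m ≤ n → (m ≤ᵇ n) ≡ true
≤ᵇ-true m≤n = Equivalence.to T-≡ (≤⇒≤ᵇ m≤n)

≤ᵇ-false : ∀ {m n} → n < m → (m ≤ᵇ n) ≡ false
≤ᵇ-false {m} {n} n<m = ¬-not λ e → <⇒≱ n<m (≤ᵇ⇒≤ m n (Equivalence.from T-≡ e))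

≡ᵇ-refl : ∀ m → (m ≡ᵇ m) ≡ true
≡ᵇ-refl zero    = refl
≡ᵇ-refl (suc m) = ≡ᵇ-refl m

≡ᵇ-false : ∀ {m n} → m ≢ n → (m ≡ᵇ n) ≡ false
≡ᵇ-false {m} {n} m≢n = ¬-not λ e → m≢n (≡ᵇ⇒≡ m n (Equivalence.from T-≡ e))

data InfixPosition (k : ℕ) : ℕ → Set where
  inLeft  : ∀ {t} → t ≤ k → InfixPosition k t
  atRoot  : InfixPosition k (suc k)
  inRight : ∀ y → InfixPosition k (suc k + suc y)

infixPosition : ∀ k t → InfixPosition k t
infixPosition k       zero          = inLeft z≤n
infixPosition zero    (suc zero)    = atRoot
infixPosition zero    (suc (suc y)) = inRight y
infixPosition (suc k) (suc t) with infixPosition k t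
... | inLeft t≤k = inLeft (s≤s t≤k)
... | atRoot     = atRoot
... | inRight y  = inRight y

a-node-left : ∀ {l} r {t} → t ≤ size l → a (node l r) t ≡ a l t
a-node-left r t≤l rewrite ≤ᵇ-true t≤l = refl

a-node-root : ∀ l r → a (node l r) (suc (size l)) ≡ size r
a-node-root l r rewrite ≤ᵇ-false (n<1+n (size l)) | ≡ᵇ-refl (size l) = refl

a-node-right : ∀ l r y → a (node l r) (suc (size l) + suc y) ≡ a r (suc y)
a-node-right l r y
  rewrite ≤ᵇ-false (m≤m+n (suc (size l)) (suc y))
        | ≡ᵇ-false (m+1+n≢m (suc (size l)) {y})
        | m+n∸m≡n (suc (size l)) (suc y) = refl

b-node-left : ∀ {l} r {t} → t ≤ size l → b (node l r) t ≡ b l t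
b-node-left r t≤l rewrite ≤ᵇ-true t≤l = refl

b-node-root : ∀ l r → b (node l r) (suc (size l)) ≡ size l
b-node-root l r rewrite ≤ᵇ-false (n<1+n (size l)) | ≡ᵇ-refl (size l) = refl

b-node-right : ∀ l r y → b (node l r) (suc (size l) + suc y) ≡ b r (suc y)
b-node-right l r y
  rewrite ≤ᵇ-false (m≤m+n (suc (size l)) (suc y))
        | ≡ᵇ-false (m+1+n≢m (suc (size l)) {y})
        | m+n∸m≡n (suc (size l)) (suc y) = refl

leftLeaf<rightLeaf : ∀ T v → leftLeaf T v < rightLeaf T v
leftLeaf<rightLeaf (node l r) here    = s≤s z≤n
leftLeaf<rightLeaf (node l r) (inl v) = leftLeaf<rightLeaf l v
leftLeaf<rightLeaf (node l r) (inr v) = +-monoʳ-< (suc (size l)) (leftLeaf<rightLeaf r v)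

rightLeaf≤size : ∀ T v → rightLeaf T v ≤ size T
rightLeaf≤size (node l r) here    = ≤-refl
rightLeaf≤size (node l r) (inl v) = ≤-trans (rightLeaf≤size l v) (m≤n⇒m≤1+n (m≤m+n (size l) (size r)))
rightLeaf≤size (node l r) (inr v) = s≤s (+-monoʳ-≤ (size l) (rightLeaf≤size r v))

rightLeaf≤leftLeaf+a : ∀ T v → 0 < leftLeaf T v →
                       rightLeaf T v ≤ leftLeaf T v + a T (leftLeaf T v)
rightLeaf≤leftLeaf+a (node l r) here ()
rightLeaf≤leftLeaf+a (node l r) (inl v) 0<ℓ
  rewrite a-node-left r (≤-trans (<⇒≤ (leftLeaf<rightLeaf l v)) (rightLeaf≤size l v)) =
  rightLeaf≤leftLeaf+a l v 0<ℓ
rightLeaf≤leftLeaf+a (node l r) (inr v) _ with leftLeaf r v | rightLeaf≤leftLeaf+a r v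
... | zero  | _ rewrite +-identityʳ (size l) | a-node-root l r =
  s≤s (+-monoʳ-≤ (size l) (rightLeaf≤size r v))
... | suc y | ih rewrite a-node-right l r y | +-assoc (suc (size l)) (suc y) (a r (suc y)) =
  +-monoʳ-≤ (suc (size l)) (ih z<s)

rightLeaf≤leftLeaf+b : ∀ T v → rightLeaf T v < size T →
                       rightLeaf T v ≤ leftLeaf T v + b T (suc (rightLeaf T v))
rightLeaf≤leftLeaf+b (node l r) here ρ<n = ⊥-elim (<-irrefl refl ρ<n)
rightLeaf≤leftLeaf+b (node l r) (inl v) _ with m≤n⇒m<n∨m≡n (rightLeaf≤size l v)
... | inj₁ ρ<l rewrite b-node-left r ρ<l = rightLeaf≤leftLeaf+b l v ρ<l
... | inj₂ ρ≡l rewrite ρ≡l | b-node-root l r = m≤n+m (size l) (leftLeaf l v)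
rightLeaf≤leftLeaf+b (node l r) (inr v) ρ<n = begin
  k + ρ                                 ≤⟨ +-monoʳ-≤ k (rightLeaf≤leftLeaf+b r v ρ<size) ⟩
  k + (ℓ + b r (suc ρ))                 ≡⟨ +-assoc k ℓ (b r (suc ρ)) ⟨
  k + ℓ + b r (suc ρ)                   ≡⟨ cong (k + ℓ +_) b-step ⟨
  k + ℓ + b (node l r) (suc (k + ρ))    ∎
  where
  open ≤-Reasoning
  k = suc (size l)
  ℓ = leftLeaf r v
  ρ = rightLeaf r v
  ρ<size : ρ < size r
  ρ<size = +-cancelˡ-< (size l) ρ (size r) (≤-pred ρ<n)
  b-step : b (node l r) (suc (k + ρ)) ≡ b r (suc ρ)
  b-step = trans (cong (b (node l r)) (sym (+-suc k ρ))) (b-node-right l r ρ)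

rightSubtreeOf : ∀ T t → 0 < a T t →
                 ∃[ v ] leftLeaf T v ≡ t × rightLeaf T v ≡ t + a T t
rightSubtreeOf leaf t ()
rightSubtreeOf (node l r) t 0<a with infixPosition (size l) t
... | inLeft t≤l rewrite a-node-left r t≤l with rightSubtreeOf l t 0<a
...   | v , ℓ≡t , ρ≡t+a = inl v , ℓ≡t , ρ≡t+a
rightSubtreeOf (node l leaf) _ 0<a | atRoot = ⊥-elim (<-irrefl (sym (a-node-root l leaf)) 0<a)
rightSubtreeOf (node l r@(node _ _)) _ _ | atRoot =
  inr here , cong suc (+-identityʳ (size l)) , cong (suc (size l) +_) (sym (a-node-root l r))
rightSubtreeOf (node l r) _ 0<a | inRight y rewrite a-node-right l r y with rightSubtreeOf r (suc y) 0<a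
... | v , ℓ≡t , ρ≡t+a =
  inr v , cong (k +_) ℓ≡t , trans (cong (k +_) ρ≡t+a) (sym (+-assoc k (suc y) (a r (suc y))))
  where k = suc (size l)

leftSubtreeOf : ∀ T s → 0 < b T (suc s) →
                ∃[ v ] leftLeaf T v + b T (suc s) ≡ s × rightLeaf T v ≡ s
leftSubtreeOf leaf s ()
leftSubtreeOf (node l r) s 0<b with infixPosition (size l) (suc s)
... | inLeft s<l rewrite b-node-left r s<l with leftSubtreeOf l s 0<b
...   | v , ℓ+b≡s , ρ≡s = inl v , ℓ+b≡s , ρ≡s
leftSubtreeOf (node leaf r) _ 0<b | atRoot = ⊥-elim (<-irrefl (sym (b-node-root leaf r)) 0<b)
leftSubtreeOf (node l@(node _ _) r) _ _ | atRoot = inl here , b-node-root l r , refl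
leftSubtreeOf (node l r) _ 0<b | inRight y rewrite b-node-right l r y with leftSubtreeOf r y 0<b
... | v , ℓ+b≡s , ρ≡s =
  inr v ,
  trans (+-assoc k (leftLeaf r v) (b r (suc y))) (trans (cong (k +_) ℓ+b≡s) k+y≡s) ,
  trans (cong (k +_) ρ≡s) k+y≡s
  where
  k = suc (size l)
  k+y≡s : k + y ≡ size l + suc y
  k+y≡s = sym (+-suc (size l) y)

Interleaved : ℕ → ℕ → ℕ → ℕ → Set
Interleaved x′ℓ x′r xℓ xr = x′ℓ < xℓ × xℓ ≤ x′r × x′r < xr

interleaved-widen : ∀ {y′ℓ x′ℓ x′r xℓ xr yr} → y′ℓ ≤ x′ℓ → xr ≤ yr →
                    Interleaved x′ℓ x′r xℓ xr → Interleaved y′ℓ x′r xℓ yr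
interleaved-widen y′ℓ≤x′ℓ xr≤yr (x′ℓ<xℓ , xℓ≤x′r , x′r<xr) =
  ≤-<-trans y′ℓ≤x′ℓ x′ℓ<xℓ , xℓ≤x′r , <-≤-trans x′r<xr xr≤yr

interleaved-resp-≡ : ∀ {x′ℓ x′r xℓ xr y′ℓ y′r yℓ yr} →
                     x′ℓ ≡ y′ℓ → x′r ≡ y′r → xℓ ≡ yℓ → xr ≡ yr →
                     Interleaved x′ℓ x′r xℓ xr → Interleaved y′ℓ y′r yℓ yr
interleaved-resp-≡ refl refl refl refl I = I

interleaved⇒0<width : ∀ {x′ℓ x′r xℓ} w → Interleaved x′ℓ x′r xℓ (xℓ + w) → 0 < w
interleaved⇒0<width {xℓ = xℓ} zero (_ , xℓ≤x′r , x′r<xℓ+0) =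
  ⊥-elim (<⇒≱ (subst (_ <_) (+-identityʳ xℓ) x′r<xℓ+0) xℓ≤x′r)
interleaved⇒0<width (suc w) _ = z<s

interleaved⇒0<width′ : ∀ {x′r xℓ xr} w → Interleaved (x′r ∸ w) x′r xℓ xr → 0 < w
interleaved⇒0<width′ zero    (x′r<xℓ , xℓ≤x′r , _) = ⊥-elim (<⇒≱ x′r<xℓ xℓ≤x′r)
interleaved⇒0<width′ (suc w) _ = z<s

FlawedPair : Arc → Arc → Set
FlawedPair lower upper =
  leftEnd upper < leftEnd lower × leftEnd lower < rightEnd upper × rightEnd upper < rightEnd lower

2*suc∸1 : ∀ t → 2 * suc t ∸ 1 ≡ suc (2 * t)
2*suc∸1 t = cong (_∸ 1) (*-suc 2 t)

lowerArc-ordered : ∀ T t → 2 * suc t ∸ 1 ≤ 2 * (suc t + a T (suc t))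
lowerArc-ordered T t = ≤-trans (m∸n≤m _ 1) (*-monoʳ-≤ 2 (m≤m+n (suc t) (a T (suc t))))

upperArc-ordered : ∀ T s → 2 * (s ∸ b T (suc s)) ≤ 2 * suc s ∸ 1
upperArc-ordered T s rewrite 2*suc∸1 s = m≤n⇒m≤1+n (*-monoʳ-≤ 2 (m∸n≤m s (b T (suc s))))

lowerArc-leftEnd : ∀ T t → leftEnd (lowerArc T (suc t)) ≡ suc (2 * t)
lowerArc-leftEnd T t = trans (m≤n⇒m⊓n≡m (lowerArc-ordered T t)) (2*suc∸1 t)

lowerArc-rightEnd : ∀ T t → rightEnd (lowerArc T (suc t)) ≡ 2 * (suc t + a T (suc t))
lowerArc-rightEnd T t = m≤n⇒m⊔n≡n (lowerArc-ordered T t)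

upperArc-leftEnd : ∀ T s → leftEnd (upperArc T (suc s)) ≡ 2 * (s ∸ b T (suc s))
upperArc-leftEnd T s = m≥n⇒m⊓n≡n (upperArc-ordered T s)

upperArc-rightEnd : ∀ T s → rightEnd (upperArc T (suc s)) ≡ suc (2 * s)
upperArc-rightEnd T s = trans (m≥n⇒m⊔n≡m (upperArc-ordered T s)) (2*suc∸1 s)

even<odd⇔< : ∀ {x y} → 2 * x < suc (2 * y) ⇔ x < suc y
even<odd⇔< = mk⇔ (λ h → s≤s (*-cancelˡ-≤ 2 (≤-pred h))) (λ h → s≤s (*-monoʳ-≤ 2 (≤-pred h)))

odd<odd⇔< : ∀ {x y} → suc (2 * x) < suc (2 * y) ⇔ x < y
odd<odd⇔< {x} {y} = mk⇔ (λ h → *-cancelˡ-< 2 x y (≤-pred h)) (λ h → s≤s (*-monoʳ-< 2 h))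

odd<even⇔< : ∀ {x y} → suc (2 * x) < 2 * y ⇔ x < y
odd<even⇔< {x} {y} =
  mk⇔ (λ h → *-cancelˡ-< 2 x y (<⇒≤ h)) (λ h → subst (_≤ 2 * y) (*-suc 2 x) (*-monoʳ-≤ 2 h))

<-resp-≡-⇔ : ∀ {x x′ y y′} → x ≡ x′ → y ≡ y′ → (x < y) ⇔ (x′ < y′)
<-resp-≡-⇔ refl refl = mk⇔ (λ h → h) (λ h → h)

flawedPair⇔interleaved : ∀ T T′ t s →
  FlawedPair (lowerArc T (suc t)) (upperArc T′ (suc s)) ⇔
  Interleaved (s ∸ b T′ (suc s)) s (suc t) (suc t + a T (suc t))
flawedPair⇔interleaved T T′ t s =
  ⇔-trans (<-resp-≡-⇔ (upperArc-leftEnd T′ s) (lowerArc-leftEnd T t)) even<odd⇔< ×-⇔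
  ⇔-trans (<-resp-≡-⇔ (lowerArc-leftEnd T t) (upperArc-rightEnd T′ s)) odd<odd⇔< ×-⇔
  ⇔-trans (<-resp-≡-⇔ (upperArc-rightEnd T′ s) (lowerArc-rightEnd T t)) odd<even⇔<

interleavedSubtrees⇒hasFlawedPair :
  ∀ T T′ v v′ → size T′ ≡ size T →
  Interleaved (leftLeaf T′ v′) (rightLeaf T′ v′) (leftLeaf T v) (rightLeaf T v) →
  HasFlawedPair (size T) T T′
interleavedSubtrees⇒hasFlawedPair T T′ v v′ T′≡T I@(_ , _ , ρ′<ρ)
  with leftLeaf T v | rightLeaf≤leftLeaf+a T v | I
... | zero  | _     | () , _
... | suc t | ρ≤t+a | I′@(_ , t<ρ′ , _) =
  suc t , suc ρ′ , (z<s , ≤-trans t<ρ′ (<⇒≤ ρ′<n)) , (z<s , ρ′<n) ,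
  Equivalence.from (flawedPair⇔interleaved T T′ t ρ′) (interleaved-widen ρ′∸b≤ℓ′ (ρ≤t+a z<s) I′)
  where
  ρ′ = rightLeaf T′ v′
  ρ′<n : ρ′ < size T
  ρ′<n = <-≤-trans ρ′<ρ (rightLeaf≤size T v)
  ρ′∸b≤ℓ′ : ρ′ ∸ b T′ (suc ρ′) ≤ leftLeaf T′ v′
  ρ′∸b≤ℓ′ = m≤n+o⇒m∸n≤o ρ′ (b T′ (suc ρ′)) (subst (ρ′ ≤_) (+-comm (leftLeaf T′ v′) _)
    (rightLeaf≤leftLeaf+b T′ v′ (subst (ρ′ <_) (sym T′≡T) ρ′<n)))

hasFlawedPair⇒interleavedSubtrees :
  ∀ {n} T T′ → HasFlawedPair n T T′ →
  ∃[ v ] ∃[ v′ ] Interleaved (leftLeaf T′ v′) (rightLeaf T′ v′) (leftLeaf T v) (rightLeaf T v)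
hasFlawedPair⇒interleavedSubtrees T T′ (zero , _ , (() , _) , _)
hasFlawedPair⇒interleavedSubtrees T T′ (suc t , zero , _ , (() , _) , _)
hasFlawedPair⇒interleavedSubtrees T T′ (suc t , suc s , _ , _ , flawed)
  with I ← Equivalence.to (flawedPair⇔interleaved T T′ t s) flawed
  with rightSubtreeOf T (suc t) (interleaved⇒0<width _ I) | leftSubtreeOf T′ s (interleaved⇒0<width′ _ I)
... | v , ℓ≡t , ρ≡t+a | v′ , ℓ′+b≡s , ρ′≡s =
  v , v′ , interleaved-resp-≡ (sym ℓ′≡s∸b) (sym ρ′≡s) (sym ℓ≡t) (sym ρ≡t+a) I
  where
  ℓ′≡s∸b : leftLeaf T′ v′ ≡ s ∸ b T′ (suc s)
  ℓ′≡s∸b = trans (sym (m+n∸n≡m (leftLeaf T′ v′) (b T′ (suc s)))) (cong (_∸ b T′ (suc s)) ℓ′+b≡s)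

lemma2p14 : (n : ℕ) (T T' : Tree) → size T ≡ n → size T' ≡ n →
    (∃[ v ] ∃[ v' ] (leftLeaf T' v' < leftLeaf T v ×
                     leftLeaf T v ≤ rightLeaf T' v' ×
                     rightLeaf T' v' < rightLeaf T v))
    ⇔ HasFlawedPair n T T'
lemma2p14 _ T T' refl T'≡T =
  mk⇔ (λ (v , v' , I) → interleavedSubtrees⇒hasFlawedPair T T' v v' T'≡T I)
      (hasFlawedPair⇒interleavedSubtrees T T')
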